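{- Let $k$ be a positive integer. If $G$ is a $\delta(G)$-regular finite simple graph, then $$d_R^k(G)\le \max\{2k-1,\ \delta(G)+k\}\le \delta(G)+2k-1.$$
   Context: Let $k\ge1$ be an integer. A Roman $k$-dominating function (RkDF) on a graph $G$ is a map $f:V(G)\to\{0,1,2\}$ such that every vertex $v$ with $f(v)=0$ has at least $k$ neighbors $u$ with $f(u)=2$. A set $\{f_1,\ldots,f_d\}$ of pairwise distinct RkDFs on $G$ with $\sum_{i=1}^d f_i(v)\le 2k$ for every $v\in V(G)$ is a Roman $(k,k)$-dominating family on $G$; the maximum number of functions in such a family is the Roman $(k,k)$-domatic number $d_R^k(G)$. -}

module Defs where

open import Data.Nat using (ℕ; _≤_)
open import Data.Bool using (Bool; true; false; if_then_else_; _∧_)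
open import Data.Fin using (Fin; toℕ)
open import Data.Fin.Properties using (_≟_)
open import Data.List using (map; allFin)
open import Data.Nat.ListAction using (sum)
open import Data.Product using (_×_)
open import Relation.Nullary.Decidable using (⌊_⌋)
open import Relation.Binary.PropositionalEquality using (_≡_)

record Graph (n : ℕ) : Set where
  field
    adj   : Fin n → Fin n → Bool
    sym   : ∀ u v → adj u v ≡ adj v u
    irrfl : ∀ v → adj v v ≡ false
open Graph public

count : (n : ℕ) → (Fin n → Bool) → ℕ
count n p = sum (map (λ u → if p u then 1 else 0) (allFin n))

deg : {n : ℕ} → Graph n → Fin n → ℕ
deg {n} G v = count n (adj G v)

Regular : {n : ℕ} → Graph n → ℕ → Set
Regular G r = ∀ v → deg G v ≡ r

-- Roman k-dominating function f : V → {0,1,2} (values Fin 3)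
isTwo : {n : ℕ} → (Fin n → Fin 3) → Fin n → Bool
isTwo f u = ⌊ toℕ (f u) Data.Nat.≟ 2 ⌋

IsRkDF : {n : ℕ} → ℕ → Graph n → (Fin n → Fin 3) → Set
IsRkDF {n} k G f =
  ∀ v → toℕ (f v) ≡ 0 → k ≤ count n (λ u → adj G v u ∧ isTwo f u)

record RomanKKFamily {n : ℕ} (k : ℕ) (G : Graph n) (d : ℕ) : Set where
  field
    fam      : Fin d → Fin n → Fin 3
    isRkDF   : ∀ i → IsRkDF k G (fam i)
    distinct : ∀ i j → (∀ v → fam i v ≡ fam j v) → i ≡ j
    bounded  : ∀ v → sum (map (λ i → toℕ (fam i v)) (allFin d)) ≤ 2 Data.Nat.* k

module Submission where

-- Write w(f) = Σ_v f(v) for the weight of a labelling.  Two regimes: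
--
-- * k ≤ δ.  For an RkDF f, every vertex v satisfies the local charge
--   inequality 2k + 2δ·[f(v)=2] ≤ (δ+k)·f(v) + 2·N₂(v), where N₂(v) counts
--   the neighbours of v labelled 2.  Double counting the edges between
--   vertices and 2-labelled neighbours gives Σ_v N₂(v) = δ·#{u : f(u)=2},
--   so summing over v yields 2kn ≤ (δ+k)·w(f).  Summing this over a family
--   of d functions and using Σ_i f_i(v) ≤ 2k at each vertex gives
--   d·2kn ≤ (δ+k)·2kn, i.e. d ≤ δ+k.
-- * δ < k.  A vertex labelled 0 would need k neighbours but has only δ,
--   so every RkDF is positive everywhere.  If d ≥ 2k, the bound
--   Σ_i f_i(v) ≤ 2k ≤ d forces every f_i(v) = 1, so all members coincide,
--   contradicting distinctness (d ≥ 2).  Hence d ≤ 2k-1.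

open import Defs hiding (sym)
open import Data.Nat using (ℕ; zero; suc; _+_; _*_; _∸_; _⊔_; _≤_; _<_; z≤n; s≤s)
open import Data.Nat.Properties
open import Data.Nat.ListAction using () renaming (sum to listSum)
open import Data.Nat.Tactic.RingSolver using (solve-∀)
open import Data.Bool using (Bool; true; false; _∧_; if_then_else_)
open import Data.Fin using (Fin; toℕ; zero; suc)
open import Data.Fin.Properties using (toℕ-injective)
open import Data.List using (map; tabulate; allFin)
open import Data.List.Properties using (map-tabulate)
open import Data.Product using (_×_; _,_)
open import Data.Empty using (⊥-elim)
open import Relation.Nullary using (yes; no)
open import Relation.Nullary.Decidable using (⌊_⌋)
open import Relation.Binary.PropositionalEquality
open import Function using (_∘_; id)
open import Algebra.Properties.Semiring.Sum +-*-semiring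
  using (sum-syntax; sum-cong-≗; ∑-distrib-+; ∑-comm; *-distribˡ-sum; *-distribʳ-sum)

∑-const : ∀ n c → ∑[ i < n ] c ≡ n * c
∑-const zero    c = refl
∑-const (suc n) c = cong (c +_) (∑-const n c)

∑-mono : ∀ {n} {g h : Fin n → ℕ} → (∀ i → g i ≤ h i) → ∑[ i < n ] g i ≤ ∑[ i < n ] h i
∑-mono {zero}  le = z≤n
∑-mono {suc n} le = +-mono-≤ (le zero) (∑-mono (le ∘ suc))

∑-mono-< : ∀ {n} {g h : Fin n → ℕ} → (∀ i → g i ≤ h i) →
           ∀ j → g j < h j → ∑[ i < n ] g i < ∑[ i < n ] h i
∑-mono-< {suc n} le zero    lt = +-mono-<-≤ lt (∑-mono (le ∘ suc))
∑-mono-< {suc n} le (suc j) lt = +-mono-≤-< (le zero) (∑-mono-< (le ∘ suc) j lt)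

∑-positive-tight : ∀ {d} (g : Fin d → ℕ) → (∀ i → 1 ≤ g i) →
                   ∑[ i < d ] g i ≤ d → ∀ i → g i ≡ 1
∑-positive-tight {d} g pos small i with g i ≟ 1
... | yes gi≡1 = gi≡1
... | no  gi≢1 = ⊥-elim (<⇒≱ too-big small)
  where
  too-big : d < ∑[ j < d ] g j
  too-big = ≤-trans (s≤s (≤-reflexive (sym (trans (∑-const d 1) (*-identityʳ d)))))
                    (∑-mono-< pos i (≤∧≢⇒< (pos i) (gi≢1 ∘ sym)))

listSum-allFin : ∀ n (g : Fin n → ℕ) → listSum (map g (allFin n)) ≡ ∑[ i < n ] g i
listSum-allFin n g = trans (cong listSum (map-tabulate id g)) (listSum-tabulate n g)
  where
  listSum-tabulate : ∀ n (h : Fin n → ℕ) → listSum (tabulate h) ≡ ∑[ i < n ] h i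
  listSum-tabulate zero    h = refl
  listSum-tabulate (suc n) h = cong (h zero +_) (listSum-tabulate n (h ∘ suc))

𝟙 : Bool → ℕ
𝟙 b = if b then 1 else 0

𝟙-∧ : ∀ a b → 𝟙 (a ∧ b) ≡ 𝟙 a * 𝟙 b
𝟙-∧ false b     = refl
𝟙-∧ true  false = refl
𝟙-∧ true  true  = refl

𝟙-∧-≤ : ∀ a b → 𝟙 (a ∧ b) ≤ 𝟙 a
𝟙-∧-≤ false b     = z≤n
𝟙-∧-≤ true  false = z≤n
𝟙-∧-≤ true  true  = ≤-refl

count≡∑ : ∀ n (p : Fin n → Bool) → count n p ≡ ∑[ u < n ] 𝟙 (p u)
count≡∑ n p = listSum-allFin n (λ u → 𝟙 (p u))

module _ {n : ℕ} (G : Graph n) where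

  neighboursWith : (Fin n → Bool) → Fin n → ℕ
  neighboursWith p v = count n (λ u → adj G v u ∧ p u)

  neighboursWith≤deg : ∀ p v → neighboursWith p v ≤ deg G v
  neighboursWith≤deg p v = begin
    neighboursWith p v                 ≡⟨ count≡∑ n _ ⟩
    ∑[ u < n ] 𝟙 (adj G v u ∧ p u)     ≤⟨ ∑-mono (λ u → 𝟙-∧-≤ (adj G v u) (p u)) ⟩
    ∑[ u < n ] 𝟙 (adj G v u)           ≡⟨ count≡∑ n (adj G v) ⟨
    deg G v                            ∎
    where open ≤-Reasoning

  deg-column : ∀ u → ∑[ v < n ] 𝟙 (adj G v u) ≡ deg G u
  deg-column u = trans (sum-cong-≗ {n} (λ v → cong 𝟙 (Graph.sym G v u)))
                       (sym (count≡∑ n (adj G u)))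

  ∑-neighboursWith : ∀ p → ∑[ v < n ] neighboursWith p v ≡ ∑[ u < n ] (deg G u * 𝟙 (p u))
  ∑-neighboursWith p = begin
    ∑[ v < n ] neighboursWith p v
      ≡⟨ sum-cong-≗ {n} (λ v → count≡∑ n _) ⟩
    ∑[ v < n ] ∑[ u < n ] 𝟙 (adj G v u ∧ p u)
      ≡⟨ sum-cong-≗ {n} (λ v → sum-cong-≗ {n} (λ u → 𝟙-∧ (adj G v u) (p u))) ⟩
    ∑[ v < n ] ∑[ u < n ] (𝟙 (adj G v u) * 𝟙 (p u))
      ≡⟨ ∑-comm (λ v u → 𝟙 (adj G v u) * 𝟙 (p u)) ⟩
    ∑[ u < n ] ∑[ v < n ] (𝟙 (adj G v u) * 𝟙 (p u))
      ≡⟨ sum-cong-≗ {n} (λ u → *-distribʳ-sum (𝟙 (p u)) (λ v → 𝟙 (adj G v u))) ⟨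
    ∑[ u < n ] ((∑[ v < n ] 𝟙 (adj G v u)) * 𝟙 (p u))
      ≡⟨ sum-cong-≗ {n} (λ u → cong (_* 𝟙 (p u)) (deg-column u)) ⟩
    ∑[ u < n ] (deg G u * 𝟙 (p u)) ∎
    where open ≡-Reasoning

  ∑-neighboursWith-regular : ∀ {δ} → Regular G δ → ∀ p →
    ∑[ v < n ] neighboursWith p v ≡ δ * ∑[ u < n ] 𝟙 (p u)
  ∑-neighboursWith-regular {δ} reg p = begin
    ∑[ v < n ] neighboursWith p v     ≡⟨ ∑-neighboursWith p ⟩
    ∑[ u < n ] (deg G u * 𝟙 (p u))    ≡⟨ sum-cong-≗ {n} (λ u → cong (_* 𝟙 (p u)) (reg u)) ⟩
    ∑[ u < n ] (δ * 𝟙 (p u))          ≡⟨ *-distribˡ-sum δ (λ u → 𝟙 (p u)) ⟨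
    δ * ∑[ u < n ] 𝟙 (p u)            ∎
    where open ≡-Reasoning

double : ∀ k → 2 * k ≡ k + k
double k = cong (k +_) (+-identityʳ k)

charge : ∀ {k δ} → k ≤ δ → (x : Fin 3) (N : ℕ) → (toℕ x ≡ 0 → k ≤ N) →
         2 * k + 𝟙 ⌊ toℕ x ≟ 2 ⌋ * (2 * δ) ≤ toℕ x * (δ + k) + 2 * N
charge {k} {δ} k≤δ zero N dominated = begin
  2 * k + 0              ≡⟨ +-identityʳ (2 * k) ⟩
  2 * k                  ≤⟨ *-monoʳ-≤ 2 (dominated refl) ⟩
  2 * N                  ∎
  where open ≤-Reasoning
charge {k} {δ} k≤δ (suc zero) N _ = begin
  2 * k + 0              ≡⟨ trans (+-identityʳ (2 * k)) (double k) ⟩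
  k + k                  ≤⟨ +-monoˡ-≤ k k≤δ ⟩
  δ + k                  ≡⟨ *-identityˡ (δ + k) ⟨
  1 * (δ + k)            ≤⟨ m≤m+n _ (2 * N) ⟩
  1 * (δ + k) + 2 * N    ∎
  where open ≤-Reasoning
charge {k} {δ} k≤δ (suc (suc zero)) N _ = begin
  2 * k + 1 * (2 * δ)    ≡⟨ regroup k δ ⟩
  2 * (δ + k)            ≤⟨ m≤m+n _ (2 * N) ⟩
  2 * (δ + k) + 2 * N    ∎
  where
  open ≤-Reasoning
  regroup : ∀ k δ → 2 * k + 1 * (2 * δ) ≡ 2 * (δ + k)
  regroup = solve-∀

weight-bound : ∀ {n k δ} (G : Graph n) → Regular G δ → k ≤ δ →
               ∀ f → IsRkDF k G f → n * (2 * k) ≤ (∑[ v < n ] toℕ (f v)) * (δ + k)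
weight-bound {n} {k} {δ} G reg k≤δ f rkdf =
  +-cancelʳ-≤ (twos * (2 * δ)) (n * (2 * k)) (weight * (δ + k)) summed
  where
  open ≤-Reasoning
  regroup : ∀ δ t → 2 * (δ * t) ≡ t * (2 * δ)
  regroup = solve-∀
  twos weight : ℕ
  twos   = ∑[ u < n ] 𝟙 (isTwo f u)
  weight = ∑[ v < n ] toℕ (f v)
  N₂ : Fin n → ℕ
  N₂ = neighboursWith G (isTwo f)
  summed : n * (2 * k) + twos * (2 * δ) ≤ weight * (δ + k) + twos * (2 * δ)
  summed = begin
    n * (2 * k) + twos * (2 * δ)
      ≡⟨ cong₂ _+_ (∑-const n (2 * k)) (sym (*-distribʳ-sum (2 * δ) (λ v → 𝟙 (isTwo f v)))) ⟨
    ∑[ v < n ] (2 * k) + ∑[ v < n ] (𝟙 (isTwo f v) * (2 * δ))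
      ≡⟨ ∑-distrib-+ (λ _ → 2 * k) (λ v → 𝟙 (isTwo f v) * (2 * δ)) ⟨
    ∑[ v < n ] (2 * k + 𝟙 (isTwo f v) * (2 * δ))
      ≤⟨ ∑-mono (λ v → charge k≤δ (f v) (N₂ v) (rkdf v)) ⟩
    ∑[ v < n ] (toℕ (f v) * (δ + k) + 2 * N₂ v)
      ≡⟨ ∑-distrib-+ (λ v → toℕ (f v) * (δ + k)) (λ v → 2 * N₂ v) ⟩
    ∑[ v < n ] (toℕ (f v) * (δ + k)) + ∑[ v < n ] (2 * N₂ v)
      ≡⟨ cong₂ _+_ (*-distribʳ-sum (δ + k) (λ v → toℕ (f v))) (*-distribˡ-sum 2 N₂) ⟨
    weight * (δ + k) + 2 * ∑[ v < n ] N₂ v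
      ≡⟨ cong (λ s → weight * (δ + k) + 2 * s) (∑-neighboursWith-regular G reg (isTwo f)) ⟩
    weight * (δ + k) + 2 * (δ * twos)
      ≡⟨ cong (weight * (δ + k) +_) (regroup δ twos) ⟩
    weight * (δ + k) + twos * (2 * δ) ∎

collapse : ∀ {d} {R : Fin d → Fin d → Set} →
           (∀ i j → R i j → i ≡ j) → (∀ i j → R i j) → d ≤ 1
collapse {zero}        _        _       = z≤n
collapse {suc zero}    _        _       = s≤s z≤n
collapse {suc (suc d)} distinct related with distinct zero (suc zero) (related zero (suc zero))
... | ()

module _ {n k δ d : ℕ} {G : Graph n} (reg : Regular G δ) (F : RomanKKFamily k G d) where

  open RomanKKFamily F

  column-bound : ∀ v → ∑[ i < d ] toℕ (fam i v) ≤ 2 * k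
  column-bound v = ≤-trans (≤-reflexive (sym (listSum-allFin d _))) (bounded v)

  -- Regime k ≤ δ: comparing total weights gives d ≤ δ + k.  (Matching on
  -- 1 ≤ k and 1 ≤ n makes n * (2 * k) visibly nonzero for the cancellation.)
  family-bound-dense : 1 ≤ k → 1 ≤ n → k ≤ δ → d ≤ δ + k
  family-bound-dense (s≤s _) (s≤s _) k≤δ = *-cancelʳ-≤ d (δ + k) (n * (2 * k)) (begin
    d * (n * (2 * k))
      ≡⟨ ∑-const d _ ⟨
    ∑[ i < d ] (n * (2 * k))
      ≤⟨ ∑-mono (λ i → weight-bound G reg k≤δ (fam i) (isRkDF i)) ⟩
    ∑[ i < d ] ((∑[ v < n ] toℕ (fam i v)) * (δ + k))
      ≡⟨ *-distribʳ-sum (δ + k) (λ i → ∑[ v < n ] toℕ (fam i v)) ⟨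
    (∑[ i < d ] ∑[ v < n ] toℕ (fam i v)) * (δ + k)
      ≡⟨ cong (_* (δ + k)) (∑-comm (λ i v → toℕ (fam i v))) ⟩
    (∑[ v < n ] ∑[ i < d ] toℕ (fam i v)) * (δ + k)
      ≤⟨ *-monoˡ-≤ (δ + k) (∑-mono column-bound) ⟩
    (∑[ v < n ] (2 * k)) * (δ + k)
      ≡⟨ cong (_* (δ + k)) (∑-const n (2 * k)) ⟩
    (n * (2 * k)) * (δ + k)
      ≡⟨ *-comm (n * (2 * k)) (δ + k) ⟩
    (δ + k) * (n * (2 * k)) ∎)
    where open ≤-Reasoning

  -- Regime δ < k: no vertex can be labelled 0, its degree is too small.
  positive : δ < k → ∀ i v → 1 ≤ toℕ (fam i v)
  positive δ<k i v with toℕ (fam i v) in fiv≡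
  ... | suc _ = s≤s z≤n
  ... | zero  = ⊥-elim (<⇒≱ δ<k (begin
    k                                      ≤⟨ isRkDF i v fiv≡ ⟩
    neighboursWith G (isTwo (fam i)) v     ≤⟨ neighboursWith≤deg G _ v ⟩
    deg G v                                ≡⟨ reg v ⟩
    δ                                      ∎))
    where open ≤-Reasoning

  -- Regime δ < k: d ≥ 2k would force all members to be the constant 1.
  family-bound-sparse : 1 ≤ k → δ < k → d ≤ 2 * k ∸ 1
  family-bound-sparse 1≤k δ<k with d <? 2 * k
  ... | yes d<2k = m+n≤o⇒m≤o∸n d (≤-trans (≤-reflexive (+-comm d 1)) d<2k)
  ... | no  d≮2k = ⊥-elim (<⇒≱ 2≤d (collapse distinct members-agree))
    where
    2k≤d : 2 * k ≤ d
    2k≤d = ≮⇒≥ d≮2k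
    2≤d : 2 ≤ d
    2≤d = ≤-trans (*-monoʳ-≤ 2 1≤k) 2k≤d
    all-one : ∀ i v → toℕ (fam i v) ≡ 1
    all-one i v = ∑-positive-tight (λ j → toℕ (fam j v)) (λ j → positive δ<k j v)
                                   (≤-trans (column-bound v) 2k≤d) i
    members-agree : ∀ i j v → fam i v ≡ fam j v
    members-agree i j v = toℕ-injective (trans (all-one i v) (sym (all-one j v)))

max-bound : ∀ {k} δ → 1 ≤ k → (2 * k ∸ 1) ⊔ (δ + k) ≤ δ + 2 * k ∸ 1
max-bound {k} δ 1≤k = ≤-trans (⊔-lub (m≤n+m (2 * k ∸ 1) δ) (+-monoʳ-≤ δ k≤2k∸1))
                              (≤-reflexive (sym (+-∸-assoc δ 1≤2k)))
  where
  1≤2k : 1 ≤ 2 * k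
  1≤2k = ≤-trans 1≤k (m≤m+n k (k + 0))
  k≤2k∸1 : k ≤ 2 * k ∸ 1
  k≤2k∸1 = m+n≤o⇒m≤o∸n k (≤-trans (+-monoʳ-≤ k 1≤k) (≤-reflexive (sym (double k))))

theorem6 : (k : ℕ) → 1 ≤ k → (n : ℕ) → 1 ≤ n → (G : Graph n) → (δ : ℕ) → Regular G δ →
    (d : ℕ) → RomanKKFamily k G d →
    (d ≤ ((2 * k ∸ 1) ⊔ (δ + k))) × (((2 * k ∸ 1) ⊔ (δ + k)) ≤ δ + 2 * k ∸ 1)
theorem6 k 1≤k n 1≤n G δ reg d F = family-bound , max-bound δ 1≤k
  where
  family-bound : d ≤ (2 * k ∸ 1) ⊔ (δ + k)
  family-bound with k ≤? δ
  ... | yes k≤δ = ≤-trans (family-bound-dense reg F 1≤k 1≤n k≤δ) (m≤n⊔m (2 * k ∸ 1) (δ + k))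
  ... | no  k≰δ = ≤-trans (family-bound-sparse reg F 1≤k (≰⇒> k≰δ)) (m≤m⊔n (2 * k ∸ 1) (δ + k))
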